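{- Let $n\geq 4$ be an integer not divisible by $5$. If $n$ has an odd prime divisor $p \neq 3$, then $B_2(C_n)=4$.
   Context: $C_n$ is the cycle with vertex set $\mathbb{Z}_n=\{0,1,\dots,n-1\}$, $i$ adjacent to $i\pm1 \pmod n$; the graph distance is $\mathrm{dist}(i,j)=\min(|i-j|,\,n-|i-j|)$. For a set $D$ of positive integers, the distance graph $G(C_n,D)$ has vertex set $\mathbb{Z}_n$, with distinct $i,j$ adjacent iff $\mathrm{dist}(i,j)\in D$; $\chi(C_n,D)$ is its chromatic number. $B_2(C_n)=\max\{\chi(C_n,D): D\subseteq\{1,\dots,\lfloor n/2\rfloor\},\ |D|=2\}$. -}

module Defs where

open import Data.Nat using (ℕ; _≤_; _⊓_; _∸_; ∣_-_∣)
open import Data.Nat.DivMod using (_/_)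
open import Data.Fin using (Fin; toℕ)
open import Data.Product using (Σ; _×_; ∃)
open import Data.Sum using (_⊎_)
open import Relation.Binary.PropositionalEquality using (_≡_; _≢_)

-- graph distance on the cycle C_n (vertices Z_n represented as Fin n)
cdist : (n : ℕ) → Fin n → Fin n → ℕ
cdist n i j = ∣ toℕ i - toℕ j ∣ ⊓ (n ∸ ∣ toℕ i - toℕ j ∣)

Adj : (n a b : ℕ) → Fin n → Fin n → Set
Adj n a b i j = i ≢ j × (cdist n i j ≡ a ⊎ cdist n i j ≡ b)

Colorable : (n a b k : ℕ) → Set
Colorable n a b k =
  Σ (Fin n → Fin k) λ c → ∀ i j → Adj n a b i j → c i ≢ c j

IsChi : (n a b k : ℕ) → Set
IsChi n a b k = Colorable n a b k × (∀ m → Colorable n a b m → k ≤ m)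

Admissible : (n a b : ℕ) → Set
Admissible n a b = 1 ≤ a × a ≤ n / 2 × 1 ≤ b × b ≤ n / 2 × a ≢ b

IsB2 : (n k : ℕ) → Set
IsB2 n k =
  (∃ λ a → ∃ λ b → Admissible n a b × IsChi n a b k)
  × (∀ a b m → Admissible n a b → IsChi n a b m → m ≤ k)

-- Upper bound: colour vertex i of G(C_n, {a, b}) by the quarter ⌊4 (s i mod n) / n⌋ of the
-- circle into which a multiplier s sends it. If s a and s b are both congruent mod n to a number
-- in [n/4, 3n/4], then vertices at distance a or b land in different quarters, so the colouring
-- is proper. Such an s exists for every admissible a < b: take s = 1 when a ≥ n/4; otherwise write
-- a = a₁ D, b = b₁ D with D = gcd a b and pick s from Bézout and a floor quotient, depending on
-- whether b₁ - a₁ is 1 or larger. For b = 2a this needs n / gcd a n ≠ 5, which 5 ∤ n guarantees.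
-- Lower bound: if n = k p then r ↦ r k embeds the square of the cycle C_p into G(C_n, {k, 2k}).
-- In a 3-colouring of it any three consecutive vertices form a triangle, so the colouring is
-- 3-periodic along the cycle; closing up the cycle forces 3 ∣ p.

module Submission where

open import Defs
open import Data.Nat using (ℕ; _≤_)
open import Data.Nat.Divisibility using (_∣_)
open import Data.Nat.Primality using (Prime)
open import Data.Product using (Σ; _×_)
open import Relation.Nullary using (¬_)
open import Relation.Binary.PropositionalEquality using (_≢_)

open import Data.Nat
open import Data.Nat.Properties
open import Data.Nat.DivMod
open import Data.Nat.Divisibility using (divides; ∣⇒≤; m%n≡0⇒n∣m)
open import Data.Nat.GCD using (GCD; gcd; gcd-GCD; gcd[m,n]≢0; module Bézout)
open import Data.Nat.Primality using (composite-≢; prime⇒¬composite; prime⇒nonZero; prime⇒nonTrivial)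
open import Data.Nat.Tactic.RingSolver using (solve)
open import Data.Fin using (Fin; toℕ; fromℕ<; inject≤)
open import Data.Fin.Properties using (all?; toℕ-fromℕ<; toℕ<n; toℕ-injective; inject≤-injective)
import Data.Fin.Properties as Fin
open import Data.List.Base using (_∷_; [])
open import Data.Product using (_,_; proj₁; proj₂)
open import Data.Sum using (_⊎_; inj₁; inj₂; swap)
import Data.Sum as Sum
open import Relation.Binary.PropositionalEquality
open import Relation.Binary.Definitions using (tri<; tri≈; tri>)
open import Relation.Nullary using (¬?; Dec; yes; no; contradiction)
open import Relation.Nullary.Decidable using (from-yes; _→-dec_)

-- Distances on the cycle

Shift : ℕ → ℕ → ℕ → ℕ → Set
Shift n d x y = x + d ≡ y ⊎ x + d ≡ y + n

+-shift : ∀ {n x d} .{{_ : NonZero n}} → x < n → d < n → Shift n d x ((x + d) % n)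
+-shift {n} {x} {d} x<n d<n with x + d <? n
... | yes x+d<n = inj₁ (sym (m<n⇒m%n≡m x+d<n))
... | no x+d≮n = inj₂ (begin
  x + d                   ≡⟨ m∸n+n≡m n≤x+d ⟨
  (x + d ∸ n) + n         ≡⟨ cong (_+ n) (m<n⇒m%n≡m x+d∸n<n) ⟨
  (x + d ∸ n) % n + n     ≡⟨ cong (_+ n) (m≤n⇒[n∸m]%m≡n%m n≤x+d) ⟩
  (x + d) % n + n         ∎)
  where
  open ≡-Reasoning
  n≤x+d : n ≤ x + d
  n≤x+d = ≮⇒≥ x+d≮n
  x+d∸n<n : x + d ∸ n < n
  x+d∸n<n = +-cancelʳ-< _ _ n (subst (_< n + n) (sym (m∸n+n≡m n≤x+d)) (+-mono-< x<n d<n))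

%-shift : ∀ {n} .{{_ : NonZero n}} x {d} → d < n → Shift n d (x % n) ((x + d) % n)
%-shift {n} x {d} d<n = subst (Shift n d (x % n)) x%n+d≡x+d (+-shift (m%n<n x n) d<n)
  where
  x%n+d≡x+d : (x % n + d) % n ≡ (x + d) % n
  x%n+d≡x+d = begin
    (x % n + d) % n       ≡⟨ cong (λ t → (x % n + t) % n) (m<n⇒m%n≡m d<n) ⟨
    (x % n + d % n) % n   ≡⟨ %-distribˡ-+ x d n ⟨
    (x + d) % n           ∎
    where open ≡-Reasoning

gap⇒shift : ∀ {n x y d} → x ≤ y → y ≤ n → ∣ x - y ∣ ⊓ (n ∸ ∣ x - y ∣) ≡ d →
            Shift n d x y ⊎ Shift n d y x
gap⇒shift {n} {x} {y} x≤y y≤n refl rewrite m≤n⇒∣m-n∣≡n∸m x≤y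
  with ⊓-sel (y ∸ x) (n ∸ (y ∸ x))
... | inj₁ min≡gap = inj₁ (inj₁ (trans (cong (x +_) min≡gap) (m+[n∸m]≡n x≤y)))
... | inj₂ min≡co-gap = inj₂ (inj₂ (begin
  y + ((y ∸ x) ⊓ (n ∸ (y ∸ x)))  ≡⟨ cong (y +_) min≡co-gap ⟩
  y + (n ∸ (y ∸ x))              ≡⟨ cong (_+ (n ∸ (y ∸ x))) (m+[n∸m]≡n x≤y) ⟨
  x + (y ∸ x) + (n ∸ (y ∸ x))    ≡⟨ +-assoc x _ _ ⟩
  x + ((y ∸ x) + (n ∸ (y ∸ x)))  ≡⟨ cong (x +_) (m+[n∸m]≡n (≤-trans (m∸n≤m y x) y≤n)) ⟩
  x + n                          ∎))
  where open ≡-Reasoning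

cdist≡⇒shift : ∀ {n} (i j : Fin n) {d} → cdist n i j ≡ d →
               Shift n d (toℕ i) (toℕ j) ⊎ Shift n d (toℕ j) (toℕ i)
cdist≡⇒shift {n} i j eq with ≤-total (toℕ i) (toℕ j)
... | inj₁ i≤j = gap⇒shift i≤j (<⇒≤ (toℕ<n j)) eq
... | inj₂ j≤i = swap (gap⇒shift j≤i (<⇒≤ (toℕ<n i))
                   (subst (λ t → t ⊓ (n ∸ t) ≡ _) (∣-∣-comm (toℕ i) (toℕ j)) eq))

1≤d∧2*d≤n⇒d<n : ∀ {d n} → 1 ≤ d → 2 * d ≤ n → d < n
1≤d∧2*d≤n⇒d<n {d} {n} 1≤d 2d≤n = <-≤-trans (m<m+n d 1≤d) (subst (_≤ n) (cong (d +_) (+-identityʳ d)) 2d≤n)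

shift⇒adjacent : ∀ {n} (i j : Fin n) {d} → 1 ≤ d → 2 * d ≤ n →
                 Shift n d (toℕ i) (toℕ j) → i ≢ j × cdist n i j ≡ d
shift⇒adjacent {n} i j {d} 1≤d 2d≤n shift = i≢j shift , cdist≡d shift
  where
  open ≡-Reasoning
  x = toℕ i
  y = toℕ j
  d≤n∸d : d ≤ n ∸ d
  d≤n∸d = m+n≤o⇒m≤o∸n d (subst (_≤ n) (cong (d +_) (+-identityʳ d)) 2d≤n)
  d<n : d < n
  d<n = 1≤d∧2*d≤n⇒d<n 1≤d 2d≤n
  i≢j : Shift n d x y → i ≢ j
  i≢j (inj₁ x+d≡y) refl = <⇒≢ (m<m+n x 1≤d) (sym x+d≡y)
  i≢j (inj₂ x+d≡x+n) refl = <⇒≢ d<n (+-cancelˡ-≡ x d n x+d≡x+n)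
  cdist≡d : Shift n d x y → cdist n i j ≡ d
  cdist≡d (inj₁ x+d≡y) = begin
    ∣ x - y ∣ ⊓ (n ∸ ∣ x - y ∣)          ≡⟨ cong (λ t → ∣ x - t ∣ ⊓ (n ∸ ∣ x - t ∣)) (sym x+d≡y) ⟩
    ∣ x - x + d ∣ ⊓ (n ∸ ∣ x - x + d ∣)  ≡⟨ cong (λ t → t ⊓ (n ∸ t)) (∣m-m+n∣≡n x d) ⟩
    d ⊓ (n ∸ d)                          ≡⟨ m≤n⇒m⊓n≡m d≤n∸d ⟩
    d                                    ∎
  cdist≡d (inj₂ x+d≡y+n) = begin
    ∣ x - y ∣ ⊓ (n ∸ ∣ x - y ∣)      ≡⟨ cong (λ t → t ⊓ (n ∸ t)) ∣x-y∣≡n∸d ⟩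
    (n ∸ d) ⊓ (n ∸ (n ∸ d))          ≡⟨ cong ((n ∸ d) ⊓_) (m∸[m∸n]≡n (<⇒≤ d<n)) ⟩
    (n ∸ d) ⊓ d                      ≡⟨ m≥n⇒m⊓n≡n d≤n∸d ⟩
    d                                ∎
    where
    ∣x-y∣≡n∸d : ∣ x - y ∣ ≡ n ∸ d
    ∣x-y∣≡n∸d = begin
      ∣ x - y ∣              ≡⟨ ∣m+n-m+o∣≡∣n-o∣ d x y ⟨
      ∣ d + x - d + y ∣      ≡⟨ cong₂ ∣_-_∣ (trans (+-comm d x) x+d≡y+n) (+-comm d y) ⟩
      ∣ y + n - y + d ∣      ≡⟨ ∣m+n-m+o∣≡∣n-o∣ y n d ⟩
      ∣ n - d ∣              ≡⟨ ∣-∣-comm n d ⟩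
      ∣ d - n ∣              ≡⟨ m≤n⇒∣m-n∣≡n∸m (<⇒≤ d<n) ⟩
      n ∸ d                  ∎

mod-+-adjacent : ∀ {n} .{{_ : NonZero n}} x {d} → 1 ≤ d → 2 * d ≤ n →
                 x mod n ≢ (x + d) mod n × cdist n (x mod n) ((x + d) mod n) ≡ d
mod-+-adjacent {n} x {d} 1≤d 2d≤n = shift⇒adjacent (x mod n) ((x + d) mod n) 1≤d 2d≤n
  (subst₂ (Shift n d) (sym (toℕ-fromℕ< _)) (sym (toℕ-fromℕ< _)) (%-shift x (1≤d∧2*d≤n⇒d<n 1≤d 2d≤n)))

-- Colourings by quarters of a multiple

m<m/n*n+n : ∀ m n .{{_ : NonZero n}} → m < m / n * n + n
m<m/n*n+n m n = begin-strict
  m                  ≡⟨ m≡m%n+[m/n]*n m n ⟩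
  m % n + m / n * n  <⟨ +-monoˡ-< _ (m%n<n m n) ⟩
  n + m / n * n      ≡⟨ +-comm n _ ⟩
  m / n * n + n      ∎
  where open ≤-Reasoning

quarter : (n : ℕ) .{{_ : NonZero n}} → ℕ → ℕ
quarter n x = 4 * (x % n) / n

quarter<4 : ∀ n .{{_ : NonZero n}} x → quarter n x < 4
quarter<4 n x = m<n*o⇒m/o<n (*-monoʳ-< 4 (m%n<n x n))

quarter-periodic : ∀ n .{{_ : NonZero n}} x t → quarter n (x + t * n) ≡ quarter n x
quarter-periodic n x t = cong (λ r → 4 * r / n) ([m+kn]%n≡m%n x t n)

shift⇒/≢ : ∀ {n} .{{_ : NonZero n}} {u v w} → n ≤ 4 * w → 4 * w ≤ 3 * n →
           Shift n w u v → 4 * u / n ≢ 4 * v / n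
shift⇒/≢ {n} {u} {v} {w} n≤4w _ (inj₁ u+w≡v) eq = <-irrefl refl (begin-strict
  4 * v                  <⟨ m<m/n*n+n (4 * v) n ⟩
  4 * v / n * n + n      ≡⟨ cong (λ t → t * n + n) eq ⟨
  4 * u / n * n + n      ≤⟨ +-mono-≤ (m/n*n≤m (4 * u) n) n≤4w ⟩
  4 * u + 4 * w          ≡⟨ *-distribˡ-+ 4 u w ⟨
  4 * (u + w)            ≡⟨ cong (4 *_) u+w≡v ⟩
  4 * v                  ∎)
  where open ≤-Reasoning
shift⇒/≢ {n} {u} {v} {w} _ 4w≤3n (inj₂ u+w≡v+n) eq = <-irrefl refl (begin-strict
  4 * u + 3 * n              <⟨ +-monoˡ-< (3 * n) (m<m/n*n+n (4 * u) n) ⟩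
  4 * u / n * n + n + 3 * n  ≡⟨ cong (λ t → t * n + n + 3 * n) eq ⟩
  4 * v / n * n + n + 3 * n  ≤⟨ +-monoˡ-≤ (3 * n) (+-monoˡ-≤ n (m/n*n≤m (4 * v) n)) ⟩
  4 * v + n + 3 * n          ≡⟨ solve (v ∷ n ∷ []) ⟨
  4 * (v + n)                ≡⟨ cong (4 *_) u+w≡v+n ⟨
  4 * (u + w)                ≡⟨ *-distribˡ-+ 4 u w ⟩
  4 * u + 4 * w              ≤⟨ +-monoʳ-≤ (4 * u) 4w≤3n ⟩
  4 * u + 3 * n              ∎)
  where open ≤-Reasoning

MiddleHalf : ℕ → ℕ → Set
MiddleHalf n a = Σ ℕ λ w → Σ ℕ λ k → a ≡ w + k * n × n ≤ 4 * w × 4 * w ≤ 3 * n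

4*m≤3*n⇒m<n : ∀ {m n} .{{_ : NonZero n}} → 4 * m ≤ 3 * n → m < n
4*m≤3*n⇒m<n {m} {n} 4m≤3n = *-cancelˡ-< 4 m n (≤-<-trans 4m≤3n (*-monoˡ-< n (n<1+n 3)))

quarter-+-middleHalf : ∀ {n} .{{_ : NonZero n}} x {a} → MiddleHalf n a → quarter n x ≢ quarter n (x + a)
quarter-+-middleHalf {n} x (w , k , refl , n≤4w , 4w≤3n) =
  subst (λ r → 4 * (x % n) / n ≢ 4 * r / n) [x+w]%n≡[x+a]%n
        (shift⇒/≢ {u = x % n} n≤4w 4w≤3n (%-shift x (4*m≤3*n⇒m<n 4w≤3n)))
  where
  [x+w]%n≡[x+a]%n : (x + w) % n ≡ (x + (w + k * n)) % n
  [x+w]%n≡[x+a]%n = trans (sym ([m+kn]%n≡m%n (x + w) k n)) (cong (_% n) (+-assoc x w (k * n)))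

shift⇒quarter≢ : ∀ {n} .{{_ : NonZero n}} s {d x y} → MiddleHalf n (s * d) → Shift n d x y →
                 quarter n (s * x) ≢ quarter n (s * y)
shift⇒quarter≢ {n} s {d} {x} {y} mh (inj₁ x+d≡y) =
  subst (λ t → quarter n (s * x) ≢ quarter n t)
        (trans (sym (*-distribˡ-+ s x d)) (cong (s *_) x+d≡y))
        (quarter-+-middleHalf (s * x) mh)
shift⇒quarter≢ {n} s {d} {x} {y} mh (inj₂ x+d≡y+n) =
  subst (quarter n (s * x) ≢_)
        (trans (cong (quarter n) sx+sd≡sy+sn) (quarter-periodic n (s * y) s))
        (quarter-+-middleHalf (s * x) mh)
  where
  sx+sd≡sy+sn : s * x + s * d ≡ s * y + s * n
  sx+sd≡sy+sn = trans (sym (*-distribˡ-+ s x d))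
                      (trans (cong (s *_) x+d≡y+n) (*-distribˡ-+ s y n))

middleHalf⇒colorable : ∀ {n a b} .{{_ : NonZero n}} s →
                       MiddleHalf n (s * a) → MiddleHalf n (s * b) → Colorable n a b 4
middleHalf⇒colorable {n} {a} {b} s mha mhb = colour , proper
  where
  colour : Fin n → Fin 4
  colour i = fromℕ< (quarter<4 n (s * toℕ i))
  colour≡⇒quarter≡ : ∀ i j → colour i ≡ colour j → quarter n (s * toℕ i) ≡ quarter n (s * toℕ j)
  colour≡⇒quarter≡ i j eq = trans (sym (toℕ-fromℕ< _)) (trans (cong toℕ eq) (toℕ-fromℕ< _))
  separated : ∀ {d} → MiddleHalf n (s * d) → ∀ i j → cdist n i j ≡ d → colour i ≢ colour j
  separated mh i j eq ci≡cj with cdist≡⇒shift i j eq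
  ... | inj₁ shift = shift⇒quarter≢ s mh shift (colour≡⇒quarter≡ i j ci≡cj)
  ... | inj₂ shift = shift⇒quarter≢ s mh shift (sym (colour≡⇒quarter≡ i j ci≡cj))
  proper : ∀ i j → Adj n a b i j → colour i ≢ colour j
  proper i j (_ , inj₁ cdist≡a) = separated mha i j cdist≡a
  proper i j (_ , inj₂ cdist≡b) = separated mhb i j cdist≡b

-- Existence of a good multiplier

Multiplier : ℕ → ℕ → ℕ → Set
Multiplier n a b = Σ ℕ λ s → MiddleHalf n (s * a) × MiddleHalf n (s * b)

middleHalf : ∀ {n w} → n ≤ 4 * w → 4 * w ≤ 3 * n → MiddleHalf n w
middleHalf {w = w} low high = w , 0 , sym (+-identityʳ w) , low , high

middleHalf-intro : ∀ {n a} k → 4 * (k * n) + n ≤ 4 * a → 4 * a ≤ 4 * (k * n) + 3 * n → MiddleHalf n a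
middleHalf-intro {n} {a} k low high = a ∸ k * n , k , sym (m∸n+n≡m kn≤a) , w-low , w-high
  where
  kn≤a : k * n ≤ a
  kn≤a = *-cancelˡ-≤ 4 (m+n≤o⇒m≤o (4 * (k * n)) low)
  4w≡4a∸4kn : 4 * (a ∸ k * n) ≡ 4 * a ∸ 4 * (k * n)
  4w≡4a∸4kn = *-distribˡ-∸ 4 a (k * n)
  w-low : n ≤ 4 * (a ∸ k * n)
  w-low = subst (n ≤_) (sym 4w≡4a∸4kn) (m+n≤o⇒m≤o∸n n (subst (_≤ 4 * a) (+-comm (4 * (k * n)) n) low))
  w-high : 4 * (a ∸ k * n) ≤ 3 * n
  w-high = subst (_≤ 3 * n) (sym 4w≡4a∸4kn) (m≤n+o⇒m∸n≤o (4 * a) (4 * (k * n)) high)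

middleHalf-fraction : ∀ {n m h w} → n ≡ m * h → m ≤ 4 * w → 4 * w ≤ 3 * m → ∀ k → MiddleHalf n (w * h + k * n)
middleHalf-fraction {n} {m} {h} {w} n≡mh m≤4w 4w≤3m k = w * h , k , refl ,
  subst₂ _≤_ (sym n≡mh) (*-assoc 4 w h) (*-monoˡ-≤ h m≤4w) ,
  subst₂ _≤_ (*-assoc 4 w h) (trans (*-assoc 3 m h) (cong (3 *_) (sym n≡mh))) (*-monoˡ-≤ h 4w≤3m)

2*b≤n⇒4*b≤2*n : ∀ {b n} → 2 * b ≤ n → 4 * b ≤ 2 * n
2*b≤n⇒4*b≤2*n {b} {n} 2b≤n = begin
  4 * b        ≡⟨ solve (b ∷ []) ⟩
  2 * (2 * b)  ≤⟨ *-monoʳ-≤ 2 2b≤n ⟩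
  2 * n        ∎
  where open ≤-Reasoning

multiplier-one : ∀ {n a b} → n ≤ 4 * a → a ≤ b → 2 * b ≤ n → Multiplier n a b
multiplier-one {n} {a} {b} n≤4a a≤b 2b≤n =
  1 , subst (MiddleHalf n) (sym (*-identityˡ a)) (middleHalf n≤4a (≤-trans (*-monoʳ-≤ 4 a≤b) 4b≤3n))
    , subst (MiddleHalf n) (sym (*-identityˡ b)) (middleHalf (≤-trans n≤4a (*-monoʳ-≤ 4 a≤b)) 4b≤3n)
  where
  4b≤3n : 4 * b ≤ 3 * n
  4b≤3n = ≤-trans (2*b≤n⇒4*b≤2*n {b} 2b≤n) (*-monoˡ-≤ n (n≤1+n 2))

middleMultiplier : (n b K : ℕ) .{{_ : NonZero b}} → ℕ
middleMultiplier n b K = _/_ ((4 * K + 3) * n) (4 * b) {{m*n≢0 4 b}}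

middleMultiplier-bounds : ∀ {n b} .{{_ : NonZero b}} K → 2 * b ≤ n →
  let s = middleMultiplier n b K in
  4 * (K * n) + n ≤ 4 * (s * b) × 4 * (s * b) ≤ 4 * (K * n) + 3 * n
middleMultiplier-bounds {n} {b} K 2b≤n = low , high
  where
  open ≤-Reasoning
  instance
    4b≢0 : NonZero (4 * b)
    4b≢0 = m*n≢0 4 b
  s = middleMultiplier n b K
  4sb≡s*4b : 4 * (s * b) ≡ s * (4 * b)
  4sb≡s*4b = trans (sym (*-assoc 4 s b)) (trans (cong (_* b) (*-comm 4 s)) (*-assoc s 4 b))
  high : 4 * (s * b) ≤ 4 * (K * n) + 3 * n
  high = begin
    4 * (s * b)            ≡⟨ 4sb≡s*4b ⟩
    s * (4 * b)            ≤⟨ m/n*n≤m ((4 * K + 3) * n) (4 * b) ⟩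
    (4 * K + 3) * n        ≡⟨ solve (K ∷ n ∷ []) ⟩
    4 * (K * n) + 3 * n    ∎
  low : 4 * (K * n) + n ≤ 4 * (s * b)
  low = <⇒≤ (+-cancelʳ-< (2 * n) _ _ (begin-strict
    4 * (K * n) + n + 2 * n  ≡⟨ solve (K ∷ n ∷ []) ⟩
    (4 * K + 3) * n          <⟨ m<m/n*n+n ((4 * K + 3) * n) (4 * b) ⟩
    s * (4 * b) + 4 * b      ≤⟨ +-monoʳ-≤ (s * (4 * b)) (2*b≤n⇒4*b≤2*n {b} 2b≤n) ⟩
    s * (4 * b) + 2 * n      ≡⟨ cong (_+ 2 * n) 4sb≡s*4b ⟨
    4 * (s * b) + 2 * n      ∎))

multiplier-near : ∀ {n a b} .{{_ : NonZero b}} → 4 * a ≤ n → 2 * b ≤ 3 * a → a ≤ b → 2 * b ≤ n →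
                  Multiplier n a b
multiplier-near {n} {a} {b} 4a≤n 2b≤3a a≤b 2b≤n =
  s , middleHalf sa-low sa-high , middleHalf sb-low sb-high
  where
  open ≤-Reasoning
  instance
    4b≢0 : NonZero (4 * b)
    4b≢0 = m*n≢0 4 b
  s = middleMultiplier n b 0
  sb-low : n ≤ 4 * (s * b)
  sb-low = proj₁ (middleMultiplier-bounds 0 2b≤n)
  sb-high : 4 * (s * b) ≤ 3 * n
  sb-high = proj₂ (middleMultiplier-bounds 0 2b≤n)
  sa-high : 4 * (s * a) ≤ 3 * n
  sa-high = ≤-trans (*-monoʳ-≤ 4 (*-monoʳ-≤ s a≤b)) sb-high
  bn+4ab≤3an : b * n + 4 * (a * b) ≤ 3 * (a * n)
  bn+4ab≤3an = begin
    b * n + 4 * (a * b)  ≡⟨ solve (a ∷ b ∷ n ∷ []) ⟩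
    b * (n + 4 * a)      ≤⟨ *-monoʳ-≤ b (+-monoʳ-≤ n 4a≤n) ⟩
    b * (n + n)          ≡⟨ solve (b ∷ n ∷ []) ⟩
    2 * b * n            ≤⟨ *-monoˡ-≤ n 2b≤3a ⟩
    3 * a * n            ≡⟨ *-assoc 3 a n ⟩
    3 * (a * n)          ∎
  expand : ∀ t → a * (t * (4 * b) + 4 * b) ≡ b * (4 * (t * a)) + 4 * (a * b)
  expand t = solve (t ∷ a ∷ b ∷ [])
  sa-low : n ≤ 4 * (s * a)
  sa-low = *-cancelˡ-≤ b (+-cancelʳ-≤ (4 * (a * b)) _ _ (begin
    b * n + 4 * (a * b)              ≤⟨ bn+4ab≤3an ⟩
    3 * (a * n)                      ≡⟨ solve (a ∷ n ∷ []) ⟩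
    a * (3 * n)                      ≤⟨ *-monoʳ-≤ a (<⇒≤ (m<m/n*n+n (3 * n) (4 * b))) ⟩
    a * (s * (4 * b) + 4 * b)        ≡⟨ expand s ⟩
    b * (4 * (s * a)) + 4 * (a * b)  ∎))

-- s b lies in the middle half of the K-th period, and a / b lies between (4M+1)/(4K+1) and
-- (4M+3)/(4K+3), so s a lies in the middle half of the M-th period.
multiplier-odd : ∀ {n a b} .{{_ : NonZero b}} K M {e} →
                 (2 * K + 1) * a ≡ (2 * M + 1) * b + e → 2 * e + a ≤ b → 2 * b ≤ n → Multiplier n a b
multiplier-odd {n} {a} {b} K M {e} eq 2e+a≤b 2b≤n =
  s , middleHalf-intro M sa-low sa-high , middleHalf-intro K sb-low sb-high
  where
  open ≤-Reasoning
  s = middleMultiplier n b K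
  sb-low : 4 * (K * n) + n ≤ 4 * (s * b)
  sb-low = proj₁ (middleMultiplier-bounds K 2b≤n)
  sb-high : 4 * (s * b) ≤ 4 * (K * n) + 3 * n
  sb-high = proj₂ (middleMultiplier-bounds K 2b≤n)
  ratio-low : b * (4 * M + 1) ≤ a * (4 * K + 1)
  ratio-low = +-cancelʳ-≤ a _ _ (begin
    b * (4 * M + 1) + a          ≤⟨ +-monoʳ-≤ (b * (4 * M + 1)) (≤-trans (m≤n+m a (2 * e)) (≤-trans 2e+a≤b (m≤m+n b (2 * e)))) ⟩
    b * (4 * M + 1) + (b + 2 * e)  ≡⟨ solve (b ∷ M ∷ e ∷ []) ⟩
    2 * ((2 * M + 1) * b + e)    ≡⟨ cong (2 *_) eq ⟨
    2 * ((2 * K + 1) * a)        ≡⟨ solve (a ∷ K ∷ []) ⟩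
    a * (4 * K + 1) + a          ∎)
  ratio-high : a * (4 * K + 3) ≤ b * (4 * M + 3)
  ratio-high = begin
    a * (4 * K + 3)                ≡⟨ solve (a ∷ K ∷ []) ⟩
    2 * ((2 * K + 1) * a) + a      ≡⟨ cong (λ t → 2 * t + a) eq ⟩
    2 * ((2 * M + 1) * b + e) + a  ≡⟨ solve (b ∷ M ∷ e ∷ a ∷ []) ⟩
    (4 * M + 2) * b + (2 * e + a)  ≤⟨ +-monoʳ-≤ _ 2e+a≤b ⟩
    (4 * M + 2) * b + b            ≡⟨ solve (b ∷ M ∷ []) ⟩
    b * (4 * M + 3)                ∎
  cross : ∀ t → b * (4 * (t * a)) ≡ a * (4 * (t * b))
  cross t = solve (t ∷ a ∷ b ∷ [])
  sa-low : 4 * (M * n) + n ≤ 4 * (s * a)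
  sa-low = *-cancelˡ-≤ b (begin
    b * (4 * (M * n) + n)    ≡⟨ solve (b ∷ M ∷ n ∷ []) ⟩
    b * (4 * M + 1) * n      ≤⟨ *-monoˡ-≤ n ratio-low ⟩
    a * (4 * K + 1) * n      ≡⟨ solve (a ∷ K ∷ n ∷ []) ⟩
    a * (4 * (K * n) + n)    ≤⟨ *-monoʳ-≤ a sb-low ⟩
    a * (4 * (s * b))        ≡⟨ cross s ⟨
    b * (4 * (s * a))        ∎)
  sa-high : 4 * (s * a) ≤ 4 * (M * n) + 3 * n
  sa-high = *-cancelˡ-≤ b (begin
    b * (4 * (s * a))          ≡⟨ cross s ⟩
    a * (4 * (s * b))          ≤⟨ *-monoʳ-≤ a sb-high ⟩
    a * (4 * (K * n) + 3 * n)  ≡⟨ solve (a ∷ K ∷ n ∷ []) ⟩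
    a * (4 * K + 3) * n        ≤⟨ *-monoˡ-≤ n ratio-high ⟩
    b * (4 * M + 3) * n        ≡⟨ solve (b ∷ M ∷ n ∷ []) ⟩
    b * (4 * (M * n) + 3 * n)  ∎)

bézout⁺ : ∀ {a n d} → 1 ≤ a → 1 ≤ n → GCD a n d → Σ ℕ λ x → Σ ℕ λ k → x * a ≡ d + k * n
bézout⁺ {zero} () _ _
bézout⁺ {suc a′} {n} {d} _ 1≤n g with Bézout.identity g | GCD.gcd∣n g
... | Bézout.+- x k d+kn≡xa | _ = x , k , sym d+kn≡xa
... | Bézout.-+ _ _ _ | divides zero n≡0 = contradiction (subst (1 ≤_) n≡0 1≤n) λ ()
-- Here x a ≡ -d (mod n); multiplying by n / d - 1 turns -d into d, and adding n keeps the
-- quotient k natural.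
... | Bézout.-+ x y d+xa≡yn | divides (suc m) n≡d+md = m * x + n , m * y + a′ , (begin
  (m * x + n) * (1 + a′)                     ≡⟨ solve (m ∷ x ∷ n ∷ a′ ∷ []) ⟩
  m * (x * (1 + a′)) + n + a′ * n            ≡⟨ cong (λ t → m * (x * (1 + a′)) + t + a′ * n) n≡d+md ⟩
  m * (x * (1 + a′)) + (d + m * d) + a′ * n  ≡⟨ solve (m ∷ x ∷ a′ ∷ d ∷ n ∷ []) ⟩
  d + m * (d + x * (1 + a′)) + a′ * n        ≡⟨ cong (λ t → d + m * t + a′ * n) d+xa≡yn ⟩
  d + m * (y * n) + a′ * n                   ≡⟨ solve (d ∷ m ∷ y ∷ n ∷ a′ ∷ []) ⟩
  d + (m * y + a′) * n                       ∎)
  where open ≡-Reasoning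

bézout-/ : ∀ {a b d a₁ b₁} .{{_ : NonZero d}} x k → x * a ≡ d + k * b → a ≡ a₁ * d → b ≡ b₁ * d →
           x * a₁ ≡ 1 + k * b₁
bézout-/ {a} {b} {d} {a₁} {b₁} x k xa≡d+kb a≡a₁d b≡b₁d = *-cancelʳ-≡ _ _ d (begin
  x * a₁ * d        ≡⟨ *-assoc x a₁ d ⟩
  x * (a₁ * d)      ≡⟨ cong (x *_) a≡a₁d ⟨
  x * a             ≡⟨ xa≡d+kb ⟩
  d + k * b         ≡⟨ cong (λ t → d + k * t) b≡b₁d ⟩
  d + k * (b₁ * d)  ≡⟨ solve (d ∷ k ∷ b₁ ∷ []) ⟩
  (1 + k * b₁) * d  ∎)
  where open ≡-Reasoning

-- r / m and 2 r / m both lie in [1/4, 3/4]; no such r exists for m = 5.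
two-quarter-point : ∀ m → 6 ≤ m → Σ ℕ λ r → m ≤ 4 * r × 8 * r ≤ 3 * m
two-quarter-point m 6≤m = r , m≤4r , 8r≤3m
  where
  open ≤-Reasoning
  r = (m + 3) / 4
  m≤4r : m ≤ 4 * r
  m≤4r = +-cancelʳ-≤ 4 _ _ (begin
    m + 4        ≡⟨ +-suc m 3 ⟩
    suc (m + 3)  ≤⟨ m<m/n*n+n (m + 3) 4 ⟩
    r * 4 + 4    ≡⟨ cong (_+ 4) (*-comm r 4) ⟩
    4 * r + 4    ∎)
  8r≤3m : 8 * r ≤ 3 * m
  8r≤3m = begin
    8 * r          ≡⟨ twice-quadruple r ⟩
    2 * (r * 4)    ≤⟨ *-monoʳ-≤ 2 (m/n*n≤m (m + 3) 4) ⟩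
    2 * (m + 3)    ≡⟨ solve (m ∷ []) ⟩
    2 * m + 6      ≤⟨ +-monoʳ-≤ (2 * m) 6≤m ⟩
    2 * m + m      ≡⟨ solve (m ∷ []) ⟩
    3 * m          ∎
    where
    twice-quadruple : ∀ t → 8 * t ≡ 2 * (t * 4)
    twice-quadruple t = solve (t ∷ [])

multiplier-double-via : ∀ {n a h m} x k r → n ≡ m * h → x * a ≡ h + k * n →
                        m ≤ 4 * r → 8 * r ≤ 3 * m → Multiplier n a (2 * a)
multiplier-double-via {n} {a} {h} {m} x k r n≡mh xa≡h+kn m≤4r 8r≤3m =
  x * r , subst (MiddleHalf n) (sym sa≡rh+rkn) (middleHalf-fraction {w = r} n≡mh m≤4r 4r≤3m (r * k))
        , subst (MiddleHalf n) (sym s2a≡2rh+2rkn) (middleHalf-fraction {w = 2 * r} n≡mh m≤8r 8r≤3m′ (2 * r * k))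
  where
  open ≡-Reasoning
  4r≤3m : 4 * r ≤ 3 * m
  4r≤3m = ≤-trans (*-monoˡ-≤ r (m≤m+n 4 4)) 8r≤3m
  m≤8r : m ≤ 4 * (2 * r)
  m≤8r = ≤-trans m≤4r (*-monoʳ-≤ 4 (m≤n*m r 2))
  8r≤3m′ : 4 * (2 * r) ≤ 3 * m
  8r≤3m′ = subst (_≤ 3 * m) 8r≡4[2r] 8r≤3m
    where
    8r≡4[2r] : 8 * r ≡ 4 * (2 * r)
    8r≡4[2r] = solve (r ∷ [])
  sa≡rh+rkn : x * r * a ≡ r * h + r * k * n
  sa≡rh+rkn = begin
    x * r * a        ≡⟨ solve (x ∷ r ∷ a ∷ []) ⟩
    r * (x * a)      ≡⟨ cong (r *_) xa≡h+kn ⟩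
    r * (h + k * n)  ≡⟨ solve (r ∷ h ∷ k ∷ n ∷ []) ⟩
    r * h + r * k * n  ∎
  s2a≡2rh+2rkn : x * r * (2 * a) ≡ 2 * r * h + 2 * r * k * n
  s2a≡2rh+2rkn = begin
    x * r * (2 * a)          ≡⟨ solve (x ∷ r ∷ a ∷ []) ⟩
    2 * (x * r * a)          ≡⟨ cong (2 *_) sa≡rh+rkn ⟩
    2 * (r * h + r * k * n)  ≡⟨ solve (r ∷ h ∷ k ∷ n ∷ []) ⟩
    2 * r * h + 2 * r * k * n  ∎

multiplier-double : ∀ {n a} .{{_ : NonZero n}} → ¬ 5 ∣ n → 1 ≤ a → 4 * a < n → Multiplier n a (2 * a)
multiplier-double {n} {a} 5∤n 1≤a 4a<n
  with bézout⁺ 1≤a (>-nonZero⁻¹ n) (gcd-GCD a n) | GCD.gcd∣n (gcd-GCD a n)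
... | x , k , xa≡h+kn | divides m n≡mh with two-quarter-point m 6≤m
  where
  open ≤-Reasoning
  h = gcd a n
  instance
    a≢0 : NonZero a
    a≢0 = >-nonZero 1≤a
  4<m : 4 < m
  4<m = *-cancelʳ-< h 4 m (begin-strict
    4 * h  ≤⟨ *-monoʳ-≤ 4 (∣⇒≤ (GCD.gcd∣m (gcd-GCD a n))) ⟩
    4 * a  <⟨ 4a<n ⟩
    n      ≡⟨ n≡mh ⟩
    m * h  ∎)
  m≢5 : m ≢ 5
  m≢5 refl = 5∤n (divides h (trans n≡mh (*-comm 5 h)))
  6≤m : 6 ≤ m
  6≤m = ≤∧≢⇒< 4<m (λ 5≡m → m≢5 (sym 5≡m))
... | r , m≤4r , 8r≤3m = multiplier-double-via x k r n≡mh xa≡h+kn m≤4r 8r≤3m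

multiplier-consecutive : ∀ {n a b a₁ D} .{{_ : NonZero n}} → ¬ 5 ∣ n → 1 ≤ a → a < b → 4 * a < n → 2 * b ≤ n →
                         a ≡ a₁ * D → b ≡ (1 + a₁) * D → Multiplier n a b
multiplier-consecutive {a₁ = zero} _ 1≤a _ _ _ a≡0 _ = contradiction (subst (1 ≤_) a≡0 1≤a) λ ()
multiplier-consecutive {n} {a} {b} {1} {D} 5∤n 1≤a _ 4a<n _ a≡D b≡2D =
  subst (Multiplier n a) 2a≡b (multiplier-double 5∤n 1≤a 4a<n)
  where
  2a≡b : 2 * a ≡ b
  2a≡b = trans (cong (2 *_) a≡D) (trans (sym (*-assoc 2 1 D)) (sym b≡2D))
multiplier-consecutive {n} {a} {b} {suc (suc j)} {D} _ 1≤a a<b 4a<n 2b≤n a≡a₁D b≡[1+a₁]D =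
  multiplier-near {{>-nonZero (≤-trans 1≤a (<⇒≤ a<b))}} (<⇒≤ 4a<n) 2b≤3a (<⇒≤ a<b) 2b≤n
  where
  open ≤-Reasoning
  2b≤3a : 2 * b ≤ 3 * a
  2b≤3a = begin
    2 * b                ≡⟨ cong (2 *_) b≡[1+a₁]D ⟩
    2 * ((3 + j) * D)    ≡⟨ solve (j ∷ D ∷ []) ⟩
    (6 + 2 * j) * D      ≤⟨ *-monoˡ-≤ D (+-monoʳ-≤ 6 (*-monoˡ-≤ j (n≤1+n 2))) ⟩
    (6 + 3 * j) * D      ≡⟨ solve (j ∷ D ∷ []) ⟩
    3 * ((2 + j) * D)    ≡⟨ cong (3 *_) a≡a₁D ⟨
    3 * a                ∎

multiplier-distant : ∀ {n a b a₁ b₁ D} .{{_ : NonZero b}} x k q e →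
                     x * a₁ ≡ 1 + k * b₁ → a ≡ a₁ * D → b ≡ b₁ * D →
                     b₁ ≡ a₁ + (e + q * 2) → e ≤ 1 → 1 ≤ q → 2 * b ≤ n → Multiplier n a b
multiplier-distant {n} {a} {b} {a₁} {b₁} {D} x k q e xa₁≡1+kb₁ a≡a₁D b≡b₁D b₁≡a₁+e+2q e≤1 1≤q 2b≤n =
  multiplier-odd (x * (q + e)) (k * (q + e)) odd-multiples 2eD+a≤b 2b≤n
  where
  open ≤-Reasoning
  odd-multiples₁ : (2 * (x * (q + e)) + 1) * a₁ ≡ (2 * (k * (q + e)) + 1) * b₁ + e
  odd-multiples₁ = begin-equality
    (2 * (x * (q + e)) + 1) * a₁                     ≡⟨ solve (x ∷ q ∷ e ∷ a₁ ∷ []) ⟩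
    2 * (q + e) * (x * a₁) + a₁                      ≡⟨ cong (λ t → 2 * (q + e) * t + a₁) xa₁≡1+kb₁ ⟩
    2 * (q + e) * (1 + k * b₁) + a₁                  ≡⟨ solve (q ∷ e ∷ k ∷ b₁ ∷ a₁ ∷ []) ⟩
    2 * (k * (q + e)) * b₁ + (a₁ + (e + q * 2)) + e  ≡⟨ cong (λ t → 2 * (k * (q + e)) * b₁ + t + e) b₁≡a₁+e+2q ⟨
    2 * (k * (q + e)) * b₁ + b₁ + e                  ≡⟨ solve (k ∷ q ∷ e ∷ b₁ ∷ []) ⟩
    (2 * (k * (q + e)) + 1) * b₁ + e                 ∎
  odd-multiples : (2 * (x * (q + e)) + 1) * a ≡ (2 * (k * (q + e)) + 1) * b + e * D
  odd-multiples = begin-equality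
    (2 * (x * (q + e)) + 1) * a                   ≡⟨ cong ((2 * (x * (q + e)) + 1) *_) a≡a₁D ⟩
    (2 * (x * (q + e)) + 1) * (a₁ * D)            ≡⟨ *-assoc (2 * (x * (q + e)) + 1) a₁ D ⟨
    (2 * (x * (q + e)) + 1) * a₁ * D              ≡⟨ cong (_* D) odd-multiples₁ ⟩
    ((2 * (k * (q + e)) + 1) * b₁ + e) * D        ≡⟨ solve (k ∷ q ∷ e ∷ b₁ ∷ D ∷ []) ⟩
    (2 * (k * (q + e)) + 1) * (b₁ * D) + e * D    ≡⟨ cong (λ t → (2 * (k * (q + e)) + 1) * t + e * D) b≡b₁D ⟨
    (2 * (k * (q + e)) + 1) * b + e * D           ∎
  2eD+a≤b : 2 * (e * D) + a ≤ b
  2eD+a≤b = begin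
    2 * (e * D) + a          ≡⟨ cong (2 * (e * D) +_) a≡a₁D ⟩
    2 * (e * D) + a₁ * D     ≡⟨ solve (e ∷ D ∷ a₁ ∷ []) ⟩
    (a₁ + 2 * e) * D         ≤⟨ *-monoˡ-≤ D (+-monoʳ-≤ a₁ 2e≤e+2q) ⟩
    (a₁ + (e + q * 2)) * D   ≡⟨ cong (_* D) b₁≡a₁+e+2q ⟨
    b₁ * D                   ≡⟨ b≡b₁D ⟨
    b                        ∎
    where
    2e≤e+2q : 2 * e ≤ e + q * 2
    2e≤e+2q = +-monoʳ-≤ e (≤-trans (≤-reflexive (+-identityʳ e)) (≤-trans e≤1 (≤-trans 1≤q (m≤m*n q 2))))

multiplier-exists : ∀ {n a b} .{{_ : NonZero n}} → ¬ 5 ∣ n → 1 ≤ a → a < b → 2 * b ≤ n → Multiplier n a b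
multiplier-exists {n} {a} {b} 5∤n 1≤a a<b 2b≤n with n ≤? 4 * a
... | yes n≤4a = multiplier-one n≤4a (<⇒≤ a<b) 2b≤n
... | no n≰4a
  with GCD.gcd∣m (gcd-GCD a b) | GCD.gcd∣n (gcd-GCD a b) | bézout⁺ 1≤a (≤-trans 1≤a (<⇒≤ a<b)) (gcd-GCD a b)
... | divides a₁ a≡a₁D | divides b₁ b≡b₁D | x , k , xa≡D+kb = by-gap (b₁ ∸ a₁) (sym (m+[n∸m]≡n (<⇒≤ a₁<b₁)))
  where
  D = gcd a b
  instance
    a≢0 : NonZero a
    a≢0 = >-nonZero 1≤a
    b≢0 : NonZero b
    b≢0 = >-nonZero (≤-trans 1≤a (<⇒≤ a<b))
    D≢0 : NonZero D
    D≢0 = ≢-nonZero (gcd[m,n]≢0 a b (inj₁ (≢-nonZero⁻¹ a)))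
  a₁<b₁ : a₁ < b₁
  a₁<b₁ = *-cancelʳ-< D a₁ b₁ (subst₂ _<_ a≡a₁D b≡b₁D a<b)
  xa₁≡1+kb₁ : x * a₁ ≡ 1 + k * b₁
  xa₁≡1+kb₁ = bézout-/ x k xa≡D+kb a≡a₁D b≡b₁D
  4a<n : 4 * a < n
  4a<n = ≰⇒> n≰4a
  by-gap : ∀ c → b₁ ≡ a₁ + c → Multiplier n a b
  by-gap zero b₁≡a₁+0 = contradiction (trans b₁≡a₁+0 (+-identityʳ a₁)) (>⇒≢ a₁<b₁)
  by-gap 1 b₁≡a₁+1 = multiplier-consecutive {a₁ = a₁} {D = D} 5∤n 1≤a a<b 4a<n 2b≤n a≡a₁D
                       (trans b≡b₁D (cong (_* D) (trans b₁≡a₁+1 (+-comm a₁ 1))))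
  by-gap (suc (suc c)) b₁≡a₁+2+c =
    multiplier-distant x k (suc (c / 2)) (c % 2) xa₁≡1+kb₁ a≡a₁D b≡b₁D
      (trans b₁≡a₁+2+c (cong (a₁ +_) 2+c≡c%2+[1+c/2]*2)) (s≤s⁻¹ (m%n<n c 2)) (s≤s z≤n) 2b≤n
    where
    2+c≡c%2+[1+c/2]*2 : 2 + c ≡ c % 2 + suc (c / 2) * 2
    2+c≡c%2+[1+c/2]*2 = trans (cong (2 +_) (m≡m%n+[m/n]*n c 2)) (2+[e+t]≡e+[2+t] (c % 2) (c / 2 * 2))
      where
      2+[e+t]≡e+[2+t] : ∀ e t → 2 + (e + t) ≡ e + (2 + t)
      2+[e+t]≡e+[2+t] e t = solve (e ∷ t ∷ [])

≤/2⇒2*≤ : ∀ {n x} → x ≤ n / 2 → 2 * x ≤ n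
≤/2⇒2*≤ {n} x≤n/2 = ≤-trans (*-monoʳ-≤ 2 x≤n/2) (≤-trans (≤-reflexive (*-comm 2 (n / 2))) (m/n*n≤m n 2))

2*≤⇒≤/2 : ∀ {n x} → 2 * x ≤ n → x ≤ n / 2
2*≤⇒≤/2 {n} {x} 2x≤n = subst (_≤ n / 2) (m*n/n≡m x 2) (/-monoˡ-≤ 2 (subst (_≤ n) (*-comm 2 x) 2x≤n))

admissible⇒colorable : ∀ {n a b} .{{_ : NonZero n}} → ¬ 5 ∣ n → Admissible n a b → Colorable n a b 4
admissible⇒colorable 5∤n (1≤a , a≤n/2 , 1≤b , b≤n/2 , a≢b) with <-cmp _ _
... | tri< a<b _ _ = let s , mha , mhb = multiplier-exists 5∤n 1≤a a<b (≤/2⇒2*≤ b≤n/2) in middleHalf⇒colorable s mha mhb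
... | tri≈ _ a≡b _ = contradiction a≡b a≢b
... | tri> _ _ b<a = let s , mhb , mha = multiplier-exists 5∤n 1≤b b<a (≤/2⇒2*≤ a≤n/2) in middleHalf⇒colorable s mha mhb

-- The lower bound

colorable-mono : ∀ {n a b k l} → k ≤ l → Colorable n a b k → Colorable n a b l
colorable-mono k≤l (c , proper) =
  (λ i → inject≤ (c i) k≤l) , λ i j adj eq → proper i j adj (inject≤-injective k≤l k≤l _ _ eq)

ThirdColour : Fin 3 → Fin 3 → Fin 3 → Fin 3 → Set
ThirdColour u v w z = u ≢ v → u ≢ w → v ≢ w → v ≢ z → w ≢ z → z ≡ u

thirdColour : ∀ u v w z → ThirdColour u v w z
thirdColour = from-yes (all? λ u → all? λ v → all? λ w → all? λ z → thirdColour? u v w z)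
  where
  thirdColour? : ∀ u v w z → Dec (ThirdColour u v w z)
  thirdColour? u v w z = ¬? (u Fin.≟ v) →-dec ¬? (u Fin.≟ w) →-dec ¬? (v Fin.≟ w) →-dec
                         ¬? (v Fin.≟ z) →-dec ¬? (w Fin.≟ z) →-dec z Fin.≟ u

3-colouring-of-steps-1-2⇒3∣period : (f : ℕ → Fin 3) → (∀ r → f r ≢ f (1 + r)) → (∀ r → f r ≢ f (2 + r)) →
                                    ∀ p → f p ≡ f 0 → 3 ∣ p
3-colouring-of-steps-1-2⇒3∣period f f≢f∘1+ f≢f∘2+ p fp≡f0 =
  m%n≡0⇒n∣m p 3 (residue (p % 3) (m%n<n p 3) (trans (sym fp≡f[p%3]) fp≡f0))
  where
  period-3 : ∀ r → f (3 + r) ≡ f r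
  period-3 r = thirdColour (f r) (f (1 + r)) (f (2 + r)) (f (3 + r))
    (f≢f∘1+ r) (f≢f∘2+ r) (f≢f∘1+ (1 + r)) (f≢f∘2+ (1 + r)) (f≢f∘1+ (2 + r))
  periodic : ∀ j r → f (j * 3 + r) ≡ f r
  periodic zero    r = refl
  periodic (suc j) r = trans (period-3 (j * 3 + r)) (periodic j r)
  fp≡f[p%3] : f p ≡ f (p % 3)
  fp≡f[p%3] = trans (cong f (trans (m≡m%n+[m/n]*n p 3) (+-comm (p % 3) _))) (periodic (p / 3) (p % 3))
  residue : ∀ t → t < 3 → f t ≡ f 0 → t ≡ 0
  residue 0 _ _ = refl
  residue 1 _ f1≡f0 = contradiction (sym f1≡f0) (f≢f∘1+ 0)
  residue 2 _ f2≡f0 = contradiction (sym f2≡f0) (f≢f∘2+ 0)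
  residue (suc (suc (suc _))) (s≤s (s≤s (s≤s ()))) _

not-3-colorable : ∀ {n k p} .{{_ : NonZero n}} → n ≡ k * p → 1 ≤ k → 2 * (2 * k) ≤ n → ¬ 3 ∣ p →
                  ¬ Colorable n k (2 * k) 3
not-3-colorable {n} {k} {p} n≡kp 1≤k 4k≤n 3∤p (c , proper) =
  3∤p (3-colouring-of-steps-1-2⇒3∣period f f≢f∘1+ f≢f∘2+ p fp≡f0)
  where
  open ≤-Reasoning
  f : ℕ → Fin 3
  f r = c ((r * k) mod n)
  2k≤n : 2 * k ≤ n
  2k≤n = ≤-trans (m≤m+n (2 * k) _) 4k≤n
  colour-+ : ∀ x d → 1 ≤ d → 2 * d ≤ n → d ≡ k ⊎ d ≡ 2 * k → c (x mod n) ≢ c ((x + d) mod n)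
  colour-+ x d 1≤d 2d≤n d∈D = proper _ _ (proj₁ adj , Sum.map (trans (proj₂ adj)) (trans (proj₂ adj)) d∈D)
    where adj = mod-+-adjacent x 1≤d 2d≤n
  f≢f∘1+ : ∀ r → f r ≢ f (1 + r)
  f≢f∘1+ r = subst (λ t → f r ≢ c (t mod n)) (+-comm (r * k) k) (colour-+ (r * k) k 1≤k 2k≤n (inj₁ refl))
  f≢f∘2+ : ∀ r → f r ≢ f (2 + r)
  f≢f∘2+ r = subst (λ t → f r ≢ c (t mod n)) rk+2k≡[2+r]k
    (colour-+ (r * k) (2 * k) (≤-trans 1≤k (m≤m+n k _)) 4k≤n (inj₂ refl))
    where
    rk+2k≡[2+r]k : r * k + 2 * k ≡ (2 + r) * k
    rk+2k≡[2+r]k = solve (r ∷ k ∷ [])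
  fp≡f0 : f p ≡ f 0
  fp≡f0 = cong c (toℕ-injective (begin-equality
    toℕ ((p * k) mod n)  ≡⟨ toℕ-fromℕ< _ ⟩
    p * k % n            ≡⟨ %-congˡ (trans (*-comm p k) (sym n≡kp)) ⟩
    n % n                ≡⟨ n%n≡0 n ⟩
    0                    ≡⟨ m*n%n≡0 0 n ⟨
    0 * k % n            ≡⟨ toℕ-fromℕ< _ ⟨
    toℕ ((0 * k) mod n)  ∎))

admissible-k-2k : ∀ {n k} → 1 ≤ k → 2 * (2 * k) ≤ n → Admissible n k (2 * k)
admissible-k-2k {n} {k} 1≤k 4k≤n =
  1≤k , 2*≤⇒≤/2 (≤-trans (m≤m+n (2 * k) _) 4k≤n) , ≤-trans 1≤k (m≤m+n k _) , 2*≤⇒≤/2 4k≤n , k≢2k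
  where
  k≢2k : k ≢ 2 * k
  k≢2k = <⇒≢ (subst (k <_) (cong (k +_) (sym (+-identityʳ k))) (m<m+n k 1≤k))

odd-prime≢3⇒4≤p : ∀ {p} → Prime p → ¬ 2 ∣ p → p ≢ 3 → 4 ≤ p
odd-prime≢3⇒4≤p {p} p-prime 2∤p p≢3 = ≤∧≢⇒< 3≤p (λ 3≡p → p≢3 (sym 3≡p))
  where
  3≤p : 3 ≤ p
  3≤p = ≤∧≢⇒< (nonTrivial⇒n>1 p {{prime⇒nonTrivial p-prime}}) (λ 2≡p → 2∤p (divides 1 (sym 2≡p)))

prime≢3⇒3∤p : ∀ {p} → Prime p → p ≢ 3 → ¬ 3 ∣ p
prime≢3⇒3∤p {p} p-prime p≢3 3∣p =
  prime⇒¬composite p-prime (composite-≢ 3 {{_}} {{prime⇒nonZero p-prime}} (λ 3≡p → p≢3 (sym 3≡p)) 3∣p)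

theorem3p3p2 : (n : ℕ) → 4 ≤ n → ¬ (5 ∣ n)
    → (Σ ℕ λ p → Prime p × p ∣ n × ¬ (2 ∣ p) × p ≢ 3)
    → IsB2 n 4
theorem3p3p2 n 4≤n 5∤n (p , p-prime , divides k n≡kp , 2∤p , p≢3) =
  (k , 2 * k , admissible , admissible⇒colorable 5∤n admissible , at-least-4) ,
  λ a b m admissible-ab (_ , minimal) → minimal 4 (admissible⇒colorable 5∤n admissible-ab)
  where
  open ≤-Reasoning
  instance
    n≢0 : NonZero n
    n≢0 = >-nonZero (≤-trans (s≤s z≤n) 4≤n)
  1≤k : 1 ≤ k
  1≤k = >-nonZero⁻¹ k {{m*n≢0⇒m≢0 k {{subst NonZero n≡kp n≢0}}}}
  4k≤n : 2 * (2 * k) ≤ n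
  4k≤n = begin
    2 * (2 * k)  ≡⟨ solve (k ∷ []) ⟩
    k * 4        ≤⟨ *-monoʳ-≤ k (odd-prime≢3⇒4≤p p-prime 2∤p p≢3) ⟩
    k * p        ≡⟨ n≡kp ⟨
    n            ∎
  admissible : Admissible n k (2 * k)
  admissible = admissible-k-2k 1≤k 4k≤n
  at-least-4 : ∀ m → Colorable n k (2 * k) m → 4 ≤ m
  at-least-4 m colorable with m ≤? 3
  ... | yes m≤3 = contradiction (colorable-mono m≤3 colorable)
                    (not-3-colorable n≡kp 1≤k 4k≤n (prime≢3⇒3∤p p-prime p≢3))
  ... | no m≰3 = ≰⇒> m≰3
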